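{- Let $n\ge 2$ and let $M$ be the $n\times n$ real matrix $$M=\begin{bmatrix} 1 & -2J_{1\times (n-1)}\\ 2J_{(n-1)\times 1} & 5I_{n-1}+2(J_{n-1}-I_{n-1})\end{bmatrix},$$ where $J_{r\times s}$ is the $r\times s$ all-ones matrix, $J_{n-1}=J_{(n-1)\times(n-1)}$ and $I_{n-1}$ is the identity matrix of order $n-1$. Then the partition $P=\{\{1\},\{2,3,\dots,n\}\}$ of $\{1,\dots,n\}$ is the smallest equitable partition of $M$, its equitable quotient matrix is $$Q=\begin{bmatrix} 1 & -2(n-1)\\ 2 & 2(n-2)+5\end{bmatrix},$$ and every distinct eigenvalue of $M$ is an eigenvalue of $Q$.
   Context: For an $n\times n$ matrix $M=(m_{rs})$ and a partition $\pi=\{C_1,\dots,C_k\}$ of $\{1,\dots,n\}$ into nonempty cells, $\pi$ is called equitable (for $M$) if for all $i,j$ the row sum $\sum_{s\in C_j} m_{rs}$ is the same number $q_{ij}$ for every $r\in C_i$; the $k\times k$ matrix $Q=(q_{ij})$ is then the equitable quotient matrix of $M$ with respect to $\pi$. "Smallest" refers to the number of cells: the one-cell partition $\{\{1,\dots,n\}\}$ is not equitable for $M$. -}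

module Defs where

open import Level using (Level; _⊔_) renaming (suc to lsuc)
open import Data.Nat using (ℕ; suc; _∸_)
open import Data.Fin using (Fin; zero; suc; _≟_)
open import Data.Product using (Σ; ∃; _×_; _,_)
open import Data.Bool using (if_then_else_)
open import Relation.Nullary using (¬_)
open import Relation.Nullary.Decidable using (⌊_⌋)
open import Relation.Binary.PropositionalEquality using (_≡_)
open import Function using (Surjective)
open import Algebra.Bundles using (CommutativeRing)
import Algebra.Definitions.RawMonoid as RawMonoidDefs

record Field (c ℓ : Level) : Set (lsuc (c ⊔ ℓ)) where
  field
    commutativeRing : CommutativeRing c ℓ
  open CommutativeRing commutativeRing public
  field
    0≉1     : ¬ (0# ≈ 1#)
    inverse : ∀ x → ¬ (x ≈ 0#) → ∃ λ y → x * y ≈ 1#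

module _ {c ℓ : Level} (K : Field c ℓ) where
  open Field K using (Carrier; _≈_; _+_; _*_; -_; 0#; 1#; +-rawMonoid)
  open RawMonoidDefs +-rawMonoid using (sum) renaming (_×_ to _·ℕ_)

  ⟦_⟧ : ℕ → Carrier
  ⟦ m ⟧ = m ·ℕ 1#

  CharZero : Set ℓ
  CharZero = ∀ m → ¬ (⟦ suc m ⟧ ≈ 0#)

  Matrix : ℕ → Set c
  Matrix n = Fin n → Fin n → Carrier

  -- the matrix M of the theorem: indices 0 ↔ 1 and suc i ↔ i+2
  --   M = [ 1   -2 J ; 2 J   5 I + 2 (J - I) ]
  M : (n : ℕ) → Matrix n
  M n zero    zero    = 1#
  M n zero    (suc j) = - ⟦ 2 ⟧
  M n (suc i) zero    = ⟦ 2 ⟧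
  M n (suc i) (suc j) = if ⌊ i ≟ j ⌋ then ⟦ 5 ⟧ else ⟦ 2 ⟧

  Q : (n : ℕ) → Matrix 2
  Q n zero       zero       = 1#
  Q n zero       (suc zero) = - (⟦ 2 ⟧ * ⟦ n ∸ 1 ⟧)
  Q n (suc zero) zero       = ⟦ 2 ⟧
  Q n (suc zero) (suc zero) = ⟦ 2 ⟧ * ⟦ n ∸ 2 ⟧ + ⟦ 5 ⟧

  -- A partition {C_1,…,C_k} of Fin n into nonempty cells is represented by a
  -- surjective cell-labelling  cell : Fin n → Fin k  (C_j = cell ⁻¹ {j}).
  IsPartition : ∀ {n k} → (Fin n → Fin k) → Set
  IsPartition cell = Surjective _≡_ _≡_ cell

  cellSum : ∀ {n k} → Matrix n → (Fin n → Fin k) → Fin n → Fin k → Carrier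
  cellSum A cell r j = sum (λ s → if ⌊ cell s ≟ j ⌋ then A r s else 0#)

  Equitable : ∀ {n k} → Matrix n → (Fin n → Fin k) → Set ℓ
  Equitable A cell =
    ∀ r r' j → cell r ≡ cell r' → cellSum A cell r j ≈ cellSum A cell r' j

  IsEquitableQuotient : ∀ {n k} → Matrix n → (Fin n → Fin k) → Matrix k → Set ℓ
  IsEquitableQuotient A cell B =
    Equitable A cell × (∀ r j → B (cell r) j ≈ cellSum A cell r j)

  IsEigenvalue : ∀ {n} → Matrix n → Carrier → Set (c ⊔ ℓ)
  IsEigenvalue {n} A λ′ =
    Σ (Fin n → Carrier) λ v →
      (∃ λ i → ¬ (v i ≈ 0#)) × (∀ r → sum (λ s → A r s * v s) ≈ λ′ * v r)

  P : ∀ {n} → Fin n → Fin 2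
  P zero    = zero
  P (suc _) = suc zero

  oneCell : ∀ {n} → Fin n → Fin 1
  oneCell _ = zero

{-# OPTIONS --safe #-}
module Submission where

-- M = 3I + c 𝟙ᵀ with c = (-2, 2, …, 2) constant on the cells of P, and Q = 3I + c̄ sᵀ where
-- c̄ = (-2, 2) lists the values of c on the cells and s = (1, n-1) the cell sizes.  For any
-- matrix μI + c dᵀ the row sum of row r over cell j is μ[r ∈ C_j] + c_r ⟨d, 1_{C_j}⟩, which
-- gives the quotient; over the single cell these are 3 ∓ 2n, distinct in characteristic 0.
-- Pairing an eigen-equation of μI + c dᵀ with d shows that every eigenvalue λ is a root of
-- (x - μ)(x - μ - ⟨d, c⟩), and ⟨𝟙, c⟩ = ⟨s, c̄⟩.  For the 2×2 matrix Q every root of this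
-- polynomial is an eigenvalue, since c̄₂ s₁ = 2 ≠ 0 keeps a column of the adjugate nonzero.

open import Defs
open import Level using (Level)
open import Data.Nat using (ℕ; _≤_; suc; s≤s)
open import Data.Fin using (Fin; zero; suc; _≟_)
open import Data.Bool using (Bool; true; false; if_then_else_)
open import Data.Product using (_×_; _,_)
open import Data.Vec.Functional using (Vector; tail)
open import Function using (_∘_)
open import Relation.Nullary using (¬_; _because_)
open import Relation.Nullary.Decidable using (⌊_⌋)
open import Relation.Binary.PropositionalEquality as ≡ using (_≡_)

module _ {c ℓ : Level} (K : Field c ℓ) where
  open Field K hiding (zero)
  open import Algebra.Properties.Semiring.Sum semiring
    using ( sum; sum-cong-≋; sum-replicate; sum-replicate-zero
          ; ∑-distrib-+; ∑-comm; *-distribˡ-sum; *-distribʳ-sum )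
  open import Algebra.Properties.Monoid.Mult +-monoid using (×-homo-+)
  open import Algebra.Properties.Ring ring using (-‿distribˡ-*; [y-z]x≈yx-zx; x[y-z]≈xy-xz)
  open import Algebra.Properties.Group +-group
    using (x≈y⇒x∙y⁻¹≈ε; x∙y⁻¹≈ε⇒x≈y; //-rightDividesˡ; //-rightDividesʳ; quasigroup)
  open import Algebra.Properties.Quasigroup quasigroup using () renaming (cancelˡ to +-cancelˡ)
  open import Algebra.Properties.CommutativeSemigroup *-commutativeSemigroup
    using (x∙yz≈y∙xz; x∙yz≈z∙yx; x∙yz≈z∙xy; xy∙z≈y∙xz)
  open import Relation.Binary.Reasoning.Setoid setoid

  infix  4 _≋ᴹ_
  infixl 6 _·I+_
  infix  7 _⊗_ _*ᵛ_

  ⟨_,_⟩ : ∀ {n} → Vector Carrier n → Vector Carrier n → Carrier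
  ⟨ u , v ⟩ = sum (λ s → u s * v s)

  _*ᵛ_ : ∀ {n} → Matrix K n → Vector Carrier n → Vector Carrier n
  (A *ᵛ v) r = ⟨ A r , v ⟩

  _≋ᴹ_ : ∀ {n} → Matrix K n → Matrix K n → Set ℓ
  A ≋ᴹ B = ∀ r s → A r s ≈ B r s

  δ : ∀ {n} → Matrix K n
  δ r s = if ⌊ r ≟ s ⌋ then 1# else 0#

  _·I+_ : ∀ {n} → Carrier → Matrix K n → Matrix K n
  (μ ·I+ N) r s = μ * δ r s + N r s

  _⊗_ : ∀ {n} → Vector Carrier n → Vector Carrier n → Matrix K n
  (u ⊗ v) r s = u r * v s

  𝟙 : ∀ {n} → Vector Carrier n
  𝟙 _ = 1#

  χ : ∀ {n k} → (Fin n → Fin k) → Fin k → Vector Carrier n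
  χ cell j s = δ (cell s) j

  x*y≈0⇒x≈0 : ∀ {x y} → ¬ y ≈ 0# → x * y ≈ 0# → x ≈ 0#
  x*y≈0⇒x≈0 {x} {y} y≉0 xy≈0 with inverse y y≉0
  ... | y⁻¹ , yy⁻¹≈1 = begin
    x             ≈⟨ *-identityʳ x ⟨
    x * 1#        ≈⟨ *-congˡ yy⁻¹≈1 ⟨
    x * (y * y⁻¹) ≈⟨ *-assoc x y y⁻¹ ⟨
    x * y * y⁻¹   ≈⟨ *-congʳ xy≈0 ⟩
    0# * y⁻¹      ≈⟨ zeroˡ y⁻¹ ⟩
    0#            ∎

  *-cancelʳ-≉0 : ∀ {x y z} → ¬ z ≈ 0# → x * z ≈ y * z → x ≈ y
  *-cancelʳ-≉0 {x} {y} {z} z≉0 xz≈yz = x∙y⁻¹≈ε⇒x≈y x y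
    (x*y≈0⇒x≈0 z≉0 (trans ([y-z]x≈yx-zx z x y) (x≈y⇒x∙y⁻¹≈ε xz≈yz)))

  ⟨𝟙,-⟩ : ∀ {n} (v : Vector Carrier n) → ⟨ 𝟙 , v ⟩ ≈ sum v
  ⟨𝟙,-⟩ v = sum-cong-≋ (λ s → *-identityˡ (v s))

  ⟨0,-⟩ : ∀ {n} (v : Vector Carrier n) → ⟨ (λ _ → 0#) , v ⟩ ≈ 0#
  ⟨0,-⟩ {n} v = trans (sum-cong-≋ (λ s → zeroˡ (v s))) (sum-replicate-zero n)

  -- Not definitional: ⌊_⌋ only computes once r ≟ s is a constructor.
  δ-suc : ∀ {n} (r s : Fin n) → δ (suc r) (suc s) ≡ δ r s
  δ-suc r s with r ≟ s
  ... | true  because _ = ≡.refl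
  ... | false because _ = ≡.refl

  δ-*ᵛ : ∀ {n} (v : Vector Carrier n) r → (δ *ᵛ v) r ≈ v r
  δ-*ᵛ v zero = begin
    1# * v zero + ⟨ (λ _ → 0#) , tail v ⟩ ≈⟨ +-cong (*-identityˡ (v zero)) (⟨0,-⟩ (tail v)) ⟩
    v zero + 0#                           ≈⟨ +-identityʳ (v zero) ⟩
    v zero                                ∎
  δ-*ᵛ v (suc r) = begin
    0# * v zero + sum (λ s → δ (suc r) (suc s) * v (suc s))
      ≈⟨ +-cong (zeroˡ (v zero)) (sum-cong-≋ (λ s → *-congʳ (reflexive (δ-suc r s)))) ⟩
    0# + (δ *ᵛ tail v) r ≈⟨ +-congˡ (δ-*ᵛ (tail v) r) ⟩
    0# + v (suc r)       ≈⟨ +-identityˡ (v (suc r)) ⟩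
    v (suc r)            ∎

  *ᵛ-·I+ : ∀ {n} {A N : Matrix K n} {μ} → A ≋ᴹ μ ·I+ N →
           ∀ v r → (A *ᵛ v) r ≈ μ * v r + (N *ᵛ v) r
  *ᵛ-·I+ {A = A} {N} {μ} A≋ v r = begin
    (A *ᵛ v) r                                  ≈⟨ sum-cong-≋ (λ s → *-congʳ (A≋ r s)) ⟩
    sum (λ s → (μ * δ r s + N r s) * v s)
      ≈⟨ sum-cong-≋ (λ s → trans (distribʳ (v s) _ _) (+-congʳ (*-assoc μ (δ r s) (v s)))) ⟩
    sum (λ s → μ * (δ r s * v s) + N r s * v s)
      ≈⟨ ∑-distrib-+ (λ s → μ * (δ r s * v s)) (λ s → N r s * v s) ⟩
    sum (λ s → μ * (δ r s * v s)) + (N *ᵛ v) r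
      ≈⟨ +-congʳ (*-distribˡ-sum μ (λ s → δ r s * v s)) ⟨
    μ * (δ *ᵛ v) r + (N *ᵛ v) r                 ≈⟨ +-congʳ (*-congˡ (δ-*ᵛ v r)) ⟩
    μ * v r + (N *ᵛ v) r                        ∎

  *ᵛ-⊗ : ∀ {n} (u d v : Vector Carrier n) r → ((u ⊗ d) *ᵛ v) r ≈ u r * ⟨ d , v ⟩
  *ᵛ-⊗ u d v r = begin
    sum (λ s → u r * d s * v s)   ≈⟨ sum-cong-≋ (λ s → *-assoc (u r) (d s) (v s)) ⟩
    sum (λ s → u r * (d s * v s)) ≈⟨ *-distribˡ-sum (u r) (λ s → d s * v s) ⟨
    u r * ⟨ d , v ⟩               ∎

  ·I+-eigenvalue : ∀ {n} {A N : Matrix K n} {μ λ′} → A ≋ᴹ μ ·I+ N →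
                   IsEigenvalue K A λ′ → IsEigenvalue K N (λ′ - μ)
  ·I+-eigenvalue {N = N} {μ} {λ′} A≋ (v , v≉0 , Av≈λv) = v , v≉0 , λ r → begin
    (N *ᵛ v) r                     ≈⟨ //-rightDividesʳ (μ * v r) ((N *ᵛ v) r) ⟨
    (N *ᵛ v) r + μ * v r - μ * v r
      ≈⟨ +-congʳ (trans (+-comm _ _) (trans (sym (*ᵛ-·I+ A≋ v r)) (Av≈λv r))) ⟩
    λ′ * v r - μ * v r             ≈⟨ [y-z]x≈yx-zx (v r) λ′ μ ⟨
    (λ′ - μ) * v r                 ∎

  ·I+-eigenvalue⁻ : ∀ {n} {A N : Matrix K n} {μ λ′} → A ≋ᴹ μ ·I+ N →
                    IsEigenvalue K N (λ′ - μ) → IsEigenvalue K A λ′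
  ·I+-eigenvalue⁻ {A = A} {N} {μ} {λ′} A≋ (v , v≉0 , Nv≈λv) = v , v≉0 , λ r → begin
    (A *ᵛ v) r               ≈⟨ *ᵛ-·I+ A≋ v r ⟩
    μ * v r + (N *ᵛ v) r     ≈⟨ +-congˡ (Nv≈λv r) ⟩
    μ * v r + (λ′ - μ) * v r ≈⟨ distribʳ (v r) μ (λ′ - μ) ⟨
    (μ + (λ′ - μ)) * v r     ≈⟨ *-congʳ (trans (+-comm μ (λ′ - μ)) (//-rightDividesˡ μ λ′)) ⟩
    λ′ * v r                 ∎

  ⊗-eigenvalue : ∀ {n} (u d : Vector Carrier n) {y} →
                 IsEigenvalue K (u ⊗ d) y → y * (y - ⟨ d , u ⟩) ≈ 0#
  ⊗-eigenvalue u d {y} (v , (k , vₖ≉0) , eig) = x*y≈0⇒x≈0 vₖ≉0 (annihilates k)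
    where
    τ = ⟨ d , u ⟩
    σ = ⟨ d , v ⟩

    uσ≈yv : ∀ r → u r * σ ≈ y * v r
    uσ≈yv r = trans (sym (*ᵛ-⊗ u d v r)) (eig r)

    yσ≈τσ : y * σ ≈ τ * σ
    yσ≈τσ = begin
      y * σ                       ≈⟨ *-distribˡ-sum y (λ s → d s * v s) ⟩
      sum (λ s → y * (d s * v s))
        ≈⟨ sum-cong-≋ (λ s → trans (x∙yz≈y∙xz y (d s) (v s)) (*-congˡ (sym (uσ≈yv s)))) ⟩
      sum (λ s → d s * (u s * σ)) ≈⟨ sum-cong-≋ (λ s → sym (*-assoc (d s) (u s) σ)) ⟩
      sum (λ s → d s * u s * σ)   ≈⟨ *-distribʳ-sum σ (λ s → d s * u s) ⟨
      τ * σ                       ∎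

    annihilates : ∀ r → y * (y - τ) * v r ≈ 0#
    annihilates r = begin
      y * (y - τ) * v r   ≈⟨ xy∙z≈y∙xz y (y - τ) (v r) ⟩
      (y - τ) * (y * v r) ≈⟨ *-congˡ (uσ≈yv r) ⟨
      (y - τ) * (u r * σ) ≈⟨ x∙yz≈y∙xz (y - τ) (u r) σ ⟩
      u r * ((y - τ) * σ) ≈⟨ *-congˡ (trans ([y-z]x≈yx-zx σ y τ) (x≈y⇒x∙y⁻¹≈ε yσ≈τσ)) ⟩
      u r * 0#            ≈⟨ zeroʳ (u r) ⟩
      0#                  ∎

  ⊗-eigenvalue₂ : (u d : Vector Carrier 2) {y : Carrier} → ¬ u (suc zero) * d zero ≈ 0# →
                  y * (y - ⟨ d , u ⟩) ≈ 0# → IsEigenvalue K (u ⊗ d) y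
  ⊗-eigenvalue₂ u d {y} u₁d₀≉0 root = w , (suc zero , u₁d₀≉0) , λ r →
    trans (*ᵛ-⊗ u d w r) (trans (*-congˡ ⟨d,w⟩≈d₀y) (row r))
    where
    -- w is minus the first column of the adjugate of u ⊗ d - y I.
    u₀ = u zero
    u₁ = u (suc zero)
    d₀ = d zero
    d₁ = d (suc zero)
    τ = ⟨ d , u ⟩

    w : Vector Carrier 2
    w zero       = y - u₁ * d₁
    w (suc zero) = u₁ * d₀

    ⟨d,w⟩≈d₀y : ⟨ d , w ⟩ ≈ d₀ * y
    ⟨d,w⟩≈d₀y = begin
      d₀ * (y - u₁ * d₁) + (d₁ * (u₁ * d₀) + 0#)
        ≈⟨ +-cong (x[y-z]≈xy-xz d₀ y (u₁ * d₁)) (trans (+-identityʳ _) (x∙yz≈z∙yx d₁ u₁ d₀)) ⟩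
      d₀ * y - d₀ * (u₁ * d₁) + d₀ * (u₁ * d₁) ≈⟨ //-rightDividesˡ (d₀ * (u₁ * d₁)) (d₀ * y) ⟩
      d₀ * y                                  ∎

    τ-u₁d₁≈d₀u₀ : τ - u₁ * d₁ ≈ d₀ * u₀
    τ-u₁d₁≈d₀u₀ = trans (+-congʳ (+-congˡ (trans (+-identityʳ _) (*-comm d₁ u₁))))
                        (//-rightDividesʳ (u₁ * d₁) (d₀ * u₀))

    yy≈yτ : y * y ≈ y * τ
    yy≈yτ = x∙y⁻¹≈ε⇒x≈y (y * y) (y * τ) (trans (sym (x[y-z]≈xy-xz y y τ)) root)

    row : ∀ r → u r * (d₀ * y) ≈ y * w r
    row zero = begin
      u₀ * (d₀ * y)         ≈⟨ x∙yz≈z∙yx u₀ d₀ y ⟩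
      y * (d₀ * u₀)         ≈⟨ *-congˡ τ-u₁d₁≈d₀u₀ ⟨
      y * (τ - u₁ * d₁)     ≈⟨ x[y-z]≈xy-xz y τ (u₁ * d₁) ⟩
      y * τ - y * (u₁ * d₁) ≈⟨ +-congʳ yy≈yτ ⟨
      y * y - y * (u₁ * d₁) ≈⟨ x[y-z]≈xy-xz y y (u₁ * d₁) ⟨
      y * (y - u₁ * d₁)     ∎
    row (suc zero) = x∙yz≈z∙xy u₁ d₀ y

  if-then-0 : ∀ (b : Bool) x → (if b then x else 0#) ≈ x * (if b then 1# else 0#)
  if-then-0 true  x = sym (*-identityʳ x)
  if-then-0 false x = sym (zeroʳ x)

  cellSum≈*ᵛχ : ∀ {n k} (A : Matrix K n) (cell : Fin n → Fin k) r j →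
                cellSum K A cell r j ≈ (A *ᵛ χ cell j) r
  cellSum≈*ᵛχ A cell r j = sum-cong-≋ (λ s → if-then-0 ⌊ cell s ≟ j ⌋ (A r s))

  cellSum-·I+⊗ : ∀ {n k} {A : Matrix K n} {μ} {u d : Vector Carrier n} → A ≋ᴹ μ ·I+ u ⊗ d →
                 ∀ (cell : Fin n → Fin k) r j →
                 cellSum K A cell r j ≈ μ * δ (cell r) j + u r * ⟨ d , χ cell j ⟩
  cellSum-·I+⊗ {A = A} {μ} {u} {d} A≋ cell r j = begin
    cellSum K A cell r j                       ≈⟨ cellSum≈*ᵛχ A cell r j ⟩
    (A *ᵛ χ cell j) r                          ≈⟨ *ᵛ-·I+ A≋ (χ cell j) r ⟩
    μ * δ (cell r) j + ((u ⊗ d) *ᵛ χ cell j) r ≈⟨ +-congˡ (*ᵛ-⊗ u d (χ cell j) r) ⟩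
    μ * δ (cell r) j + u r * ⟨ d , χ cell j ⟩  ∎

  quotient⇒equitable : ∀ {n k} {A : Matrix K n} {cell : Fin n → Fin k} {B : Matrix K k} →
                       (∀ r j → B (cell r) j ≈ cellSum K A cell r j) → Equitable K A cell
  quotient⇒equitable {B = B} B≈ r r′ j cell-r≡cell-r′ =
    trans (sym (B≈ r j)) (trans (reflexive (≡.cong (λ i → B i j) cell-r≡cell-r′)) (B≈ r′ j))

  cellWeight : ∀ {n k} → (Fin n → Fin k) → Vector Carrier n → Vector Carrier k
  cellWeight cell d j = ⟨ d , χ cell j ⟩

  ·I+⊗-isEquitableQuotient : ∀ {n k} {A : Matrix K n} {B : Matrix K k} {μ}
    (cell : Fin n → Fin k) (ū : Vector Carrier k) (d : Vector Carrier n) →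
    A ≋ᴹ μ ·I+ (ū ∘ cell) ⊗ d → B ≋ᴹ μ ·I+ ū ⊗ cellWeight cell d →
    IsEquitableQuotient K A cell B
  ·I+⊗-isEquitableQuotient {A = A} {B} cell ū d A≋ B≋ =
    quotient⇒equitable {B = B} B≈cellSum , B≈cellSum
    where
    B≈cellSum : ∀ r j → B (cell r) j ≈ cellSum K A cell r j
    B≈cellSum r j = trans (B≋ (cell r) j) (sym (cellSum-·I+⊗ A≋ cell r j))

  ⟨d,ū∘cell⟩≈⟨cellWeight,ū⟩ : ∀ {n k} (cell : Fin n → Fin k) (ū : Vector Carrier k)
                              (d : Vector Carrier n) →
                              ⟨ d , ū ∘ cell ⟩ ≈ ⟨ cellWeight cell d , ū ⟩
  ⟨d,ū∘cell⟩≈⟨cellWeight,ū⟩ cell ū d = begin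
    sum (λ s → d s * ū (cell s))
      ≈⟨ sum-cong-≋ (λ s → *-congˡ (δ-*ᵛ ū (cell s))) ⟨
    sum (λ s → d s * sum (λ j → δ (cell s) j * ū j))
      ≈⟨ sum-cong-≋ (λ s → *-distribˡ-sum (d s) (λ j → δ (cell s) j * ū j)) ⟩
    sum (λ s → sum (λ j → d s * (δ (cell s) j * ū j)))
      ≈⟨ ∑-comm (λ s j → d s * (δ (cell s) j * ū j)) ⟩
    sum (λ j → sum (λ s → d s * (δ (cell s) j * ū j)))
      ≈⟨ sum-cong-≋ (λ j → sum-cong-≋ (λ s → sym (*-assoc (d s) (δ (cell s) j) (ū j)))) ⟩
    sum (λ j → sum (λ s → d s * χ cell j s * ū j))
      ≈⟨ sum-cong-≋ (λ j → *-distribʳ-sum (ū j) (λ s → d s * χ cell j s)) ⟨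
    ⟨ cellWeight cell d , ū ⟩
      ∎

  ·I+⊗-quotient-eigenvalue : ∀ {n} {A : Matrix K n} {B : Matrix K 2} {μ λ′}
    (cell : Fin n → Fin 2) (ū : Vector Carrier 2) (d : Vector Carrier n) →
    A ≋ᴹ μ ·I+ (ū ∘ cell) ⊗ d → B ≋ᴹ μ ·I+ ū ⊗ cellWeight cell d →
    ¬ ū (suc zero) * cellWeight cell d zero ≈ 0# →
    IsEigenvalue K A λ′ → IsEigenvalue K B λ′
  ·I+⊗-quotient-eigenvalue {μ = μ} {λ′} cell ū d A≋ B≋ ū₁w₀≉0 eigenvalue =
    ·I+-eigenvalue⁻ B≋ (⊗-eigenvalue₂ ū (cellWeight cell d) ū₁w₀≉0 root)
    where
    y = λ′ - μ
    root : y * (y - ⟨ cellWeight cell d , ū ⟩) ≈ 0#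
    root = trans (*-congˡ (+-congˡ (-‿cong (sym (⟨d,ū∘cell⟩≈⟨cellWeight,ū⟩ cell ū d)))))
                 (⊗-eigenvalue (ū ∘ cell) d (·I+-eigenvalue A≋ eigenvalue))

  ·I+⊗-oneCell-equitable⇒ : ∀ {n} {A : Matrix K n} {μ} {u d : Vector Carrier n} →
                            A ≋ᴹ μ ·I+ u ⊗ d → Equitable K A (oneCell K) →
                            ∀ r r′ → u r * ⟨ d , 𝟙 ⟩ ≈ u r′ * ⟨ d , 𝟙 ⟩
  ·I+⊗-oneCell-equitable⇒ {A = A} {μ} {u} {d} A≋ equitable r r′ =
    +-cancelˡ (μ * 1#) _ _ (begin
    μ * 1# + u r * ⟨ d , 𝟙 ⟩        ≈⟨ cellSum-·I+⊗ A≋ (oneCell K) r zero ⟨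
    cellSum K A (oneCell K) r zero  ≈⟨ equitable r r′ zero ≡.refl ⟩
    cellSum K A (oneCell K) r′ zero ≈⟨ cellSum-·I+⊗ A≋ (oneCell K) r′ zero ⟩
    μ * 1# + u r′ * ⟨ d , 𝟙 ⟩       ∎)

  private
    [_] : ℕ → Carrier
    [_] = ⟦_⟧ K

  rowOffset : Vector Carrier 2
  rowOffset zero    = - [ 2 ]
  rowOffset (suc _) = [ 2 ]

  x≈μ*0+x : ∀ μ x → x ≈ μ * 0# + x
  x≈μ*0+x μ x = sym (trans (+-congʳ (zeroʳ μ)) (+-identityˡ x))

  x≈μ*0+x*1 : ∀ μ x → x ≈ μ * 0# + x * 1#
  x≈μ*0+x*1 μ x = trans (x≈μ*0+x μ x) (+-congˡ (sym (*-identityʳ x)))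

  1≈3*1-2*1 : 1# ≈ [ 3 ] * 1# + - [ 2 ] * 1#
  1≈3*1-2*1 = begin
    1#                        ≈⟨ //-rightDividesʳ [ 2 ] 1# ⟨
    [ 3 ] - [ 2 ]             ≈⟨ +-cong (*-identityʳ [ 3 ]) (*-identityʳ (- [ 2 ])) ⟨
    [ 3 ] * 1# + - [ 2 ] * 1# ∎

  M≋3I+rowOffset∘P⊗𝟙 : ∀ n → M K n ≋ᴹ [ 3 ] ·I+ (rowOffset ∘ P K) ⊗ 𝟙
  M≋3I+rowOffset∘P⊗𝟙 n zero    zero    = 1≈3*1-2*1
  M≋3I+rowOffset∘P⊗𝟙 n zero    (suc j) = x≈μ*0+x*1 [ 3 ] _
  M≋3I+rowOffset∘P⊗𝟙 n (suc i) zero    = x≈μ*0+x*1 [ 3 ] _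
  M≋3I+rowOffset∘P⊗𝟙 n (suc i) (suc j) with i ≟ j
  ... | true  because _ =
    trans (×-homo-+ 1# 3 2) (+-cong (sym (*-identityʳ [ 3 ])) (sym (*-identityʳ [ 2 ])))
  ... | false because _ = x≈μ*0+x*1 [ 3 ] _

  P-cellSize : ∀ n → Vector Carrier 2
  P-cellSize n = cellWeight (P K {n}) 𝟙

  P-cellSize₀ : ∀ k → P-cellSize (suc k) zero ≈ 1#
  P-cellSize₀ k = trans (⟨𝟙,-⟩ (χ (P K {suc k}) zero))
                        (trans (+-congˡ (sum-replicate-zero k)) (+-identityʳ 1#))

  P-cellSize₁ : ∀ k → P-cellSize (suc k) (suc zero) ≈ [ k ]
  P-cellSize₁ k = trans (⟨𝟙,-⟩ (χ (P K {suc k}) (suc zero)))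
                        (trans (+-congˡ (sum-replicate k)) (+-identityˡ [ k ]))

  Q≋3I+rowOffset⊗P-cellSize : ∀ m →
    Q K (suc (suc m)) ≋ᴹ [ 3 ] ·I+ rowOffset ⊗ P-cellSize (suc (suc m))
  Q≋3I+rowOffset⊗P-cellSize m zero zero =
    trans 1≈3*1-2*1 (+-congˡ (*-congˡ (sym (P-cellSize₀ (suc m)))))
  Q≋3I+rowOffset⊗P-cellSize m zero (suc zero) = begin
    - ([ 2 ] * [ suc m ])                                      ≈⟨ -‿distribˡ-* [ 2 ] [ suc m ] ⟩
    - [ 2 ] * [ suc m ]                                        ≈⟨ *-congˡ (P-cellSize₁ (suc m)) ⟨
    - [ 2 ] * P-cellSize (suc (suc m)) (suc zero)              ≈⟨ x≈μ*0+x [ 3 ] _ ⟩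
    [ 3 ] * 0# + - [ 2 ] * P-cellSize (suc (suc m)) (suc zero) ∎
  Q≋3I+rowOffset⊗P-cellSize m (suc zero) zero =
    trans (x≈μ*0+x*1 [ 3 ] [ 2 ]) (+-congˡ (*-congˡ (sym (P-cellSize₀ (suc m)))))
  Q≋3I+rowOffset⊗P-cellSize m (suc zero) (suc zero) = begin
    [ 2 ] * [ m ] + [ 5 ]           ≈⟨ +-comm _ [ 5 ] ⟩
    [ 5 ] + [ 2 ] * [ m ]           ≈⟨ +-congʳ (×-homo-+ 1# 3 2) ⟩
    [ 3 ] + [ 2 ] + [ 2 ] * [ m ]   ≈⟨ +-assoc [ 3 ] [ 2 ] _ ⟩
    [ 3 ] + ([ 2 ] + [ 2 ] * [ m ])
      ≈⟨ +-cong (*-identityʳ [ 3 ]) (trans (distribˡ [ 2 ] 1# [ m ]) (+-congʳ (*-identityʳ [ 2 ]))) ⟨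
    [ 3 ] * 1# + [ 2 ] * [ suc m ]  ≈⟨ +-congˡ (*-congˡ (P-cellSize₁ (suc m))) ⟨
    [ 3 ] * 1# + [ 2 ] * P-cellSize (suc (suc m)) (suc zero) ∎

  P-surjective : ∀ m → IsPartition K {suc (suc m)} (P K)
  P-surjective m zero       = zero , λ { ≡.refl → ≡.refl }
  P-surjective m (suc zero) = suc zero , λ { ≡.refl → ≡.refl }

  M-isEquitableQuotient : ∀ m → IsEquitableQuotient K (M K (suc (suc m))) (P K) (Q K (suc (suc m)))
  M-isEquitableQuotient m =
    ·I+⊗-isEquitableQuotient (P K) rowOffset 𝟙 (M≋3I+rowOffset∘P⊗𝟙 _) (Q≋3I+rowOffset⊗P-cellSize m)

  module _ (charZero : CharZero K) where

    M-oneCell-notEquitable : ∀ m → ¬ Equitable K (M K (suc (suc m))) (oneCell K)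
    M-oneCell-notEquitable m equitable = charZero 3 (begin
      [ 4 ]           ≈⟨ ×-homo-+ 1# 2 2 ⟩
      [ 2 ] + [ 2 ]   ≈⟨ +-congˡ -2≈2 ⟨
      [ 2 ] + - [ 2 ] ≈⟨ -‿inverseʳ [ 2 ] ⟩
      0#              ∎)
      where
      n≉0 : ¬ ⟨ 𝟙 , 𝟙 {suc (suc m)} ⟩ ≈ 0#
      n≉0 n≈0 = charZero (suc m)
        (trans (sym (trans (⟨𝟙,-⟩ (𝟙 {suc (suc m)})) (sum-replicate (suc (suc m))))) n≈0)

      -2≈2 : - [ 2 ] ≈ [ 2 ]
      -2≈2 = *-cancelʳ-≉0 n≉0
        (·I+⊗-oneCell-equitable⇒ (M≋3I+rowOffset∘P⊗𝟙 _) equitable zero (suc zero))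

    M-eigenvalue⇒Q-eigenvalue : ∀ m λ′ → IsEigenvalue K (M K (suc (suc m))) λ′ →
                                IsEigenvalue K (Q K (suc (suc m))) λ′
    M-eigenvalue⇒Q-eigenvalue m _ =
      ·I+⊗-quotient-eigenvalue (P K) rowOffset 𝟙
        (M≋3I+rowOffset∘P⊗𝟙 _) (Q≋3I+rowOffset⊗P-cellSize m) 2*size₀≉0
      where
      2*size₀≉0 : ¬ [ 2 ] * P-cellSize (suc (suc m)) zero ≈ 0#
      2*size₀≉0 eq =
        charZero 1 (trans (sym (trans (*-congˡ (P-cellSize₀ (suc m))) (*-identityʳ [ 2 ]))) eq)

mainTheorem1 : {c ℓ : Level} (K : Field c ℓ) → CharZero K →
    (n : ℕ) → 2 ≤ n →
      IsPartition K {n} (P K)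
      × IsEquitableQuotient K (M K n) (P K) (Q K n)
      × ¬ Equitable K (M K n) (oneCell K)
      × (∀ λ′ → IsEigenvalue K (M K n) λ′ → IsEigenvalue K (Q K n) λ′)
mainTheorem1 K charZero (suc (suc m)) (s≤s (s≤s _)) =
    P-surjective K m
  , M-isEquitableQuotient K m
  , M-oneCell-notEquitable K charZero m
  , M-eigenvalue⇒Q-eigenvalue K charZero m
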